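{- Let $a_0,\ldots,a_{15}\in\mathbb{Z}$, define $b_i=(a_i+a_{i+8})+(a_{i+4}+a_{i+12})$, $c_i=(a_i+a_{i+8})-(a_{i+4}+a_{i+12})$ ($0\le i\le3$), $d_i=a_i-a_{i+8}$ ($0\le i\le7$), $\bm d=(d_0,\ldots,d_7)$ and $d=(d_0+d_2)(d_4+d_6)+(d_1+d_3)(d_5+d_7)$. Then: (1) If $b_0+b_2\equiv b_1+b_3\equiv0\pmod 2$, then $F(\bm d)\in 2^2\mathbb{Z}_{\rm odd}$ when $b_0+b_1+b_2+b_3\not\equiv c_0+c_1+c_2+c_3\pmod 4$, and $F(\bm d)\in 2^4\mathbb{Z}$ when $b_0+b_1+b_2+b_3\equiv c_0+c_1+c_2+c_3\pmod 4$. (2) If $b_0+b_2\equiv b_1+b_3\equiv1\pmod 2$, then $F(\bm d)\in2^3\mathbb{Z}_{\rm odd}$ when $d\equiv2\pmod4$, and $F(\bm d)\in2^4\mathbb{Z}$ when $d\equiv0\pmod 4$.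
   Context: For $k\in\{0,1\}$ let $f_k(x,y,z,w)=x^2+y^2+(-1)^kz^2+(-1)^kw^2$, and $F(w_0,\ldots,w_7)=f_0(w_0-w_2,w_4-w_6,w_1-w_3,w_5-w_7)\,f_1(w_0+w_2,w_4+w_6,w_1+w_3,w_5+w_7)$. $\mathbb{Z}_{\rm odd}$ is the set of odd integers; $2^j\mathbb{Z}_{\rm odd}=\{2^jn\mid n\text{ odd}\}$. -}

module Defs where

open import Data.Nat using (ℕ)
open import Data.Integer using (ℤ; +_; _+_; _-_; _*_; -_)
open import Data.Integer.Divisibility using (_∣_)
open import Data.Fin using (Fin; #_)
open import Data.Product using (∃; _×_)
open import Relation.Binary.PropositionalEquality using (_≡_)
open import Relation.Nullary using (¬_)

sgn : Fin 2 → ℤ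
sgn Fin.zero = + 1
sgn (Fin.suc _) = - (+ 1)

f : Fin 2 → ℤ → ℤ → ℤ → ℤ → ℤ
f k x y z w = x * x + y * y + sgn k * (z * z) + sgn k * (w * w)

F : (Fin 8 → ℤ) → ℤ
F w = f (# 0) (w (# 0) - w (# 2)) (w (# 4) - w (# 6)) (w (# 1) - w (# 3)) (w (# 5) - w (# 7))
    * f (# 1) (w (# 0) + w (# 2)) (w (# 4) + w (# 6)) (w (# 1) + w (# 3)) (w (# 5) + w (# 7))

_≡_[mod_] : ℤ → ℤ → ℤ → Set
x ≡ y [mod m ] = m ∣ (x - y)

infix 4 _≡_[mod_]

Odd : ℤ → Set
Odd n = ¬ (+ 2 ∣ n)

-- x ∈ 2^j ℤ_odd  (pow2 j given as the integer 2^j)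
In2ʲOdd : ℤ → ℤ → Set
In2ʲOdd p x = ∃ λ n → Odd n × x ≡ p * n

In2ʲℤ : ℤ → ℤ → Set
In2ʲℤ p x = p ∣ x

module _ (a : Fin 16 → ℤ) where
  b0 b1 b2 b3 c0 c1 c2 c3 : ℤ
  b0 = (a (# 0) + a (# 8))  + (a (# 4) + a (# 12))
  b1 = (a (# 1) + a (# 9))  + (a (# 5) + a (# 13))
  b2 = (a (# 2) + a (# 10)) + (a (# 6) + a (# 14))
  b3 = (a (# 3) + a (# 11)) + (a (# 7) + a (# 15))
  c0 = (a (# 0) + a (# 8))  - (a (# 4) + a (# 12))
  c1 = (a (# 1) + a (# 9))  - (a (# 5) + a (# 13))
  c2 = (a (# 2) + a (# 10)) - (a (# 6) + a (# 14))
  c3 = (a (# 3) + a (# 11)) - (a (# 7) + a (# 15))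

  dvec : Fin 8 → ℤ
  dvec Fin.zero = a (# 0) - a (# 8)
  dvec (Fin.suc Fin.zero) = a (# 1) - a (# 9)
  dvec (Fin.suc (Fin.suc Fin.zero)) = a (# 2) - a (# 10)
  dvec (Fin.suc (Fin.suc (Fin.suc Fin.zero))) = a (# 3) - a (# 11)
  dvec (Fin.suc (Fin.suc (Fin.suc (Fin.suc Fin.zero)))) = a (# 4) - a (# 12)
  dvec (Fin.suc (Fin.suc (Fin.suc (Fin.suc (Fin.suc Fin.zero))))) = a (# 5) - a (# 13)
  dvec (Fin.suc (Fin.suc (Fin.suc (Fin.suc (Fin.suc (Fin.suc Fin.zero)))))) = a (# 6) - a (# 14)
  dvec (Fin.suc (Fin.suc (Fin.suc (Fin.suc (Fin.suc (Fin.suc (Fin.suc Fin.zero))))))) = a (# 7) - a (# 15)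

  dsc : ℤ
  dsc = (dvec (# 0) + dvec (# 2)) * (dvec (# 4) + dvec (# 6))
      + (dvec (# 1) + dvec (# 3)) * (dvec (# 5) + dvec (# 7))

{-# OPTIONS --safe #-}
-- Put p = d₀+d₂, q = d₄+d₆, r = d₁+d₃, t = d₅+d₇. The second factor of F(𝐝) is f₁(p,q,r,t),
-- and since dᵢ − dⱼ ≡ dᵢ + dⱼ (mod 2) while x ≡ y (mod 2m) forces x² ≡ y² (mod 4m), the first
-- factor is ≡ f₀(p,q,r,t) (mod 4). The hypotheses only see p+q and r+t mod 2, d = pq+rt mod 4
-- and Σbᵢ − Σcᵢ ≡ 2(q+t) (mod 4); the factors are needed mod 4 and mod 8, where they depend
-- only on p, q, r, t mod 4. So everything reduces to a check over the 4⁴ residue classes: in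
-- the four cases the two factors lie in (2·odd, 2·odd), (4ℤ, 4ℤ), (2·odd, 4·odd), (2·odd, 8ℤ).
module Submission where

open import Defs
open import Data.Integer using (ℤ; +_; _+_; _-_; _*_; -_; ∣_∣)
open import Data.Integer.Divisibility using (_∣_)
import Data.Integer.Divisibility.Signed as Signed
open import Data.Integer.DivMod using (_%_; _/_; n%d<d; a≡a%n+[a/n]*n)
open import Data.Integer.Properties using (+-identityʳ)
open import Data.Integer.Tactic.RingSolver using (solve)
open import Data.Nat using (NonZero)
import Data.Nat.Divisibility as ℕ
open import Data.Fin using (Fin; toℕ; fromℕ<; #_)
open import Data.Fin.Properties using (all?; toℕ-fromℕ<)
open import Data.List using (_∷_; [])
open import Data.Product using (∃; _×_; _,_; proj₁; proj₂; map)
open import Function using (_∘_; _⇔_; mk⇔; Equivalence)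
open import Relation.Nullary using (¬_; Dec; contradiction)
open import Relation.Nullary.Decidable using (map′; _×-dec_; _→-dec_; ¬?; from-yes)
open import Relation.Binary.PropositionalEquality
  using (_≡_; refl; sym; cong; subst; module ≡-Reasoning)

private variable
  m n x y z x′ y′ z′ w w′ : ℤ

infix 4 _≡_⟨mod_⟩

-- Unlike _≡_[mod_], which unfolds to divisibility of absolute values, this carries the
-- quotient, so its indices are recovered by unification and ring identities close the proofs.
record _≡_⟨mod_⟩ (x y m : ℤ) : Set where
  constructor _,_
  field
    quotient : ℤ
    equation : x ≡ y + quotient * m

[mod]⇒⟨mod⟩ : x ≡ y [mod m ] → x ≡ y ⟨mod m ⟩
[mod]⇒⟨mod⟩ {x} {y} {m} x≡y with Signed.∣ᵤ⇒∣ x≡y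
... | Signed.divides k x-y≡km = k , (begin
  x             ≡⟨ solve (x ∷ y ∷ []) ⟩
  y + (x - y)   ≡⟨ cong (λ u → y + u) x-y≡km ⟩
  y + k * m     ∎)
  where open ≡-Reasoning

⟨mod⟩⇒[mod] : x ≡ y ⟨mod m ⟩ → x ≡ y [mod m ]
⟨mod⟩⇒[mod] {y = y} {m = m} (k , refl) = Signed.∣⇒∣ᵤ m∣difference
  where
  m∣difference : m Signed.∣ (y + k * m) - y
  m∣difference = Signed.divides k (solve (y ∷ k ∷ m ∷ []))

⟨mod⟩-reflexive : x ≡ y → x ≡ y ⟨mod m ⟩
⟨mod⟩-reflexive {y = y} {m = m} refl = + 0 , solve (y ∷ m ∷ [])

⟨mod⟩-refl : x ≡ x ⟨mod m ⟩
⟨mod⟩-refl = ⟨mod⟩-reflexive refl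

⟨mod⟩-sym : x ≡ y ⟨mod m ⟩ → y ≡ x ⟨mod m ⟩
⟨mod⟩-sym {y = y} {m = m} (k , refl) = - k , solve (y ∷ k ∷ m ∷ [])

⟨mod⟩-trans : x ≡ y ⟨mod m ⟩ → y ≡ z ⟨mod m ⟩ → x ≡ z ⟨mod m ⟩
⟨mod⟩-trans {m = m} {z = z} (k , refl) (l , refl) = k + l , solve (z ∷ k ∷ l ∷ m ∷ [])

⟨mod⟩-respˡ : x ≡ x′ ⟨mod m ⟩ → x ≡ z ⟨mod m ⟩ → x′ ≡ z ⟨mod m ⟩
⟨mod⟩-respˡ = ⟨mod⟩-trans ∘ ⟨mod⟩-sym

+-cong-⟨mod⟩ : x ≡ x′ ⟨mod m ⟩ → y ≡ y′ ⟨mod m ⟩ → x + y ≡ x′ + y′ ⟨mod m ⟩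
+-cong-⟨mod⟩ {x′ = x′} {m = m} {y′ = y′} (k , refl) (l , refl) =
  k + l , solve (x′ ∷ y′ ∷ k ∷ l ∷ m ∷ [])

*-cong-⟨mod⟩ : x ≡ x′ ⟨mod m ⟩ → y ≡ y′ ⟨mod m ⟩ → x * y ≡ x′ * y′ ⟨mod m ⟩
*-cong-⟨mod⟩ {x′ = x′} {m = m} {y′ = y′} (k , refl) (l , refl) =
  k * y′ + x′ * l + k * l * m , solve (x′ ∷ y′ ∷ k ∷ l ∷ m ∷ [])

⟨mod⟩-divisor : m Signed.∣ n → x ≡ y ⟨mod n ⟩ → x ≡ y ⟨mod m ⟩
⟨mod⟩-divisor {m} {y = y} (Signed.divides c refl) (k , refl) = k * c , solve (y ∷ k ∷ c ∷ m ∷ [])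

+-cancelˡ-⟨mod⟩ : x + y ≡ x + z ⟨mod m ⟩ → y ≡ z ⟨mod m ⟩
+-cancelˡ-⟨mod⟩ {x} {y} {z} {m = m} x+y≡x+z =
  [mod]⇒⟨mod⟩ (subst (m ∣_) difference (⟨mod⟩⇒[mod] x+y≡x+z))
  where
  difference : (x + y) - (x + z) ≡ y - z
  difference = solve (x ∷ y ∷ z ∷ [])

≡+⇒[≡⇔≡0] : x ≡ y + z ⟨mod m ⟩ → (x ≡ y ⟨mod m ⟩ ⇔ z ≡ + 0 ⟨mod m ⟩)
≡+⇒[≡⇔≡0] {y = y} {z} {m} x≡y+z = mk⇔
  (λ x≡y → +-cancelˡ-⟨mod⟩ {y} {z} (⟨mod⟩-respˡ x≡y+z (⟨mod⟩-trans x≡y y≡y+0)))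
  (λ z≡0 → ⟨mod⟩-trans x≡y+z (⟨mod⟩-trans (+-cong-⟨mod⟩ (⟨mod⟩-refl {y}) z≡0) (⟨mod⟩-sym y≡y+0)))
  where
  y≡y+0 : y ≡ y + + 0 ⟨mod m ⟩
  y≡y+0 = ⟨mod⟩-reflexive (sym (+-identityʳ y))

square-cong-⟨mod⟩ : ∀ m → x ≡ y ⟨mod m * + 2 ⟩ → x * x ≡ y * y ⟨mod m * + 4 ⟩
square-cong-⟨mod⟩ {y = y} m (k , refl) = y * k + k * k * m , solve (y ∷ k ∷ m ∷ [])

f-cong-⟨mod⟩ : ∀ i m → x ≡ x′ ⟨mod m * + 2 ⟩ → y ≡ y′ ⟨mod m * + 2 ⟩ →
               z ≡ z′ ⟨mod m * + 2 ⟩ → w ≡ w′ ⟨mod m * + 2 ⟩ →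
               f i x y z w ≡ f i x′ y′ z′ w′ ⟨mod m * + 4 ⟩
f-cong-⟨mod⟩ i m x≡ y≡ z≡ w≡ =
  +-cong-⟨mod⟩ (+-cong-⟨mod⟩ (+-cong-⟨mod⟩ (square-cong-⟨mod⟩ m x≡) (square-cong-⟨mod⟩ m y≡))
                              (*-cong-⟨mod⟩ (⟨mod⟩-refl {sgn i}) (square-cong-⟨mod⟩ m z≡)))
               (*-cong-⟨mod⟩ (⟨mod⟩-refl {sgn i}) (square-cong-⟨mod⟩ m w≡))

infix 4 _≡_⟨mod_⟩?

_≡_⟨mod_⟩? : ∀ x y m → Dec (x ≡ y ⟨mod m ⟩)
x ≡ y ⟨mod m ⟩? = map′ [mod]⇒⟨mod⟩ ⟨mod⟩⇒[mod] (∣ m ∣ ℕ.∣? ∣ x - y ∣)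

residue : ∀ n .{{_ : NonZero n}} x → ∃ λ (i : Fin n) → x ≡ + toℕ i ⟨mod + n ⟩
residue n x = fromℕ< x%n<n , x / + n , (begin
  x                            ≡⟨ a≡a%n+[a/n]*n x (+ n) ⟩
  + (x % + n) + (x / + n) * + n ≡⟨ cong (λ i → + i + (x / + n) * + n) (sym (toℕ-fromℕ< x%n<n)) ⟩
  + toℕ (fromℕ< x%n<n) + (x / + n) * + n ∎)
  where
  open ≡-Reasoning
  x%n<n = n%d<d x (+ n)

-⟨mod⟩+ : ∀ x y → x - y ≡ x + y ⟨mod + 2 ⟩
-⟨mod⟩+ x y = - y , solve (x ∷ y ∷ [])

OddMultiple : ℤ → ℤ → Set
OddMultiple m x = x ≡ m ⟨mod m * + 2 ⟩

1+k*2-odd : ∀ k → Odd (+ 1 + k * + 2)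
1+k*2-odd k 2∣1+k*2 = contradiction (ℕ.∣1⇒≡1 (Signed.∣⇒∣ᵤ 2∣1)) λ ()
  where
  2∣1 : + 2 Signed.∣ + 1
  2∣1 = Signed.∣m+n∣n⇒∣m (Signed.∣ᵤ⇒∣ 2∣1+k*2) (Signed.divides k refl)

OddMultiple-* : OddMultiple m x → OddMultiple n y → OddMultiple (m * n) (x * y)
OddMultiple-* {m} {n = n} (k , refl) (l , refl) = k + l + k * l * + 2 , solve (m ∷ n ∷ k ∷ l ∷ [])

OddMultiple⇒In2ʲOdd : OddMultiple m x → In2ʲOdd m x
OddMultiple⇒In2ʲOdd {m} (k , refl) = + 1 + k * + 2 , 1+k*2-odd k , solve (m ∷ k ∷ [])

OddMultiple⇒∣ : OddMultiple m x → m Signed.∣ x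
OddMultiple⇒∣ {m} (k , refl) = Signed.divides (+ 1 + k * + 2) (solve (m ∷ k ∷ []))

≡0⇒∣ : x ≡ + 0 ⟨mod m ⟩ → m Signed.∣ x
≡0⇒∣ {m = m} (k , refl) = Signed.divides k (solve (k ∷ m ∷ []))

*-pres-∣ : m Signed.∣ x → n Signed.∣ y → m * n Signed.∣ x * y
*-pres-∣ {m} {n = n} (Signed.divides k refl) (Signed.divides l refl) =
  Signed.divides (k * l) (solve (m ∷ n ∷ k ∷ l ∷ []))

f₀ f₁ : ℤ → ℤ → ℤ → ℤ → ℤ
f₀ = f (# 0)
f₁ = f (# 1)

FactorsWhenSumsEven FactorsWhenSumsOdd : ℤ → ℤ → ℤ → ℤ → Set
FactorsWhenSumsEven p q r t = p + q ≡ + 0 ⟨mod + 2 ⟩ × r + t ≡ + 0 ⟨mod + 2 ⟩ →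
  (¬ (+ 2 * (q + t) ≡ + 0 ⟨mod + 4 ⟩) → f₀ p q r t ≡ + 2 ⟨mod + 4 ⟩ × f₁ p q r t ≡ + 2 ⟨mod + 4 ⟩)
  × (+ 2 * (q + t) ≡ + 0 ⟨mod + 4 ⟩ → f₀ p q r t ≡ + 0 ⟨mod + 4 ⟩ × f₁ p q r t ≡ + 0 ⟨mod + 4 ⟩)
FactorsWhenSumsOdd p q r t = p + q ≡ + 1 ⟨mod + 2 ⟩ × r + t ≡ + 1 ⟨mod + 2 ⟩ →
  (p * q + r * t ≡ + 2 ⟨mod + 4 ⟩ → f₀ p q r t ≡ + 2 ⟨mod + 4 ⟩ × f₁ p q r t ≡ + 4 ⟨mod + 8 ⟩)
  × (p * q + r * t ≡ + 0 ⟨mod + 4 ⟩ → f₀ p q r t ≡ + 2 ⟨mod + 4 ⟩ × f₁ p q r t ≡ + 0 ⟨mod + 8 ⟩)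

FactorCongruences : ℤ → ℤ → ℤ → ℤ → Set
FactorCongruences p q r t = FactorsWhenSumsEven p q r t × FactorsWhenSumsOdd p q r t

factorCongruences? : ∀ p q r t → Dec (FactorCongruences p q r t)
factorCongruences? p q r t = even? ×-dec odd?
  where
  even? : Dec (FactorsWhenSumsEven p q r t)
  even? = (p + q ≡ + 0 ⟨mod + 2 ⟩? ×-dec r + t ≡ + 0 ⟨mod + 2 ⟩?) →-dec
    ((¬? (+ 2 * (q + t) ≡ + 0 ⟨mod + 4 ⟩?) →-dec
        (f₀ p q r t ≡ + 2 ⟨mod + 4 ⟩? ×-dec f₁ p q r t ≡ + 2 ⟨mod + 4 ⟩?))
     ×-dec (+ 2 * (q + t) ≡ + 0 ⟨mod + 4 ⟩? →-dec
        (f₀ p q r t ≡ + 0 ⟨mod + 4 ⟩? ×-dec f₁ p q r t ≡ + 0 ⟨mod + 4 ⟩?)))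
  odd? : Dec (FactorsWhenSumsOdd p q r t)
  odd? = (p + q ≡ + 1 ⟨mod + 2 ⟩? ×-dec r + t ≡ + 1 ⟨mod + 2 ⟩?) →-dec
    ((p * q + r * t ≡ + 2 ⟨mod + 4 ⟩? →-dec
        (f₀ p q r t ≡ + 2 ⟨mod + 4 ⟩? ×-dec f₁ p q r t ≡ + 4 ⟨mod + 8 ⟩?))
     ×-dec (p * q + r * t ≡ + 0 ⟨mod + 4 ⟩? →-dec
        (f₀ p q r t ≡ + 2 ⟨mod + 4 ⟩? ×-dec f₁ p q r t ≡ + 0 ⟨mod + 8 ⟩?)))

factorCongruences-residues : ∀ (i j k l : Fin 4) →
  FactorCongruences (+ toℕ i) (+ toℕ j) (+ toℕ k) (+ toℕ l)
factorCongruences-residues = from-yes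
  (all? λ (i : Fin 4) → all? λ (j : Fin 4) → all? λ (k : Fin 4) → all? λ (l : Fin 4) →
     factorCongruences? (+ toℕ i) (+ toℕ j) (+ toℕ k) (+ toℕ l))

module _ {p q r t p′ q′ r′ t′ : ℤ}
         (p≡ : p ≡ p′ ⟨mod + 4 ⟩) (q≡ : q ≡ q′ ⟨mod + 4 ⟩)
         (r≡ : r ≡ r′ ⟨mod + 4 ⟩) (t≡ : t ≡ t′ ⟨mod + 4 ⟩) where

  private
    2∣4 : + 2 Signed.∣ + 4
    2∣4 = Signed.divides (+ 2) refl

    4∣8 : + 4 Signed.∣ + 8
    4∣8 = Signed.divides (+ 2) refl

    sums≡ : (p + q ≡ p′ + q′ ⟨mod + 2 ⟩) × (r + t ≡ r′ + t′ ⟨mod + 2 ⟩)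
    sums≡ = ⟨mod⟩-divisor 2∣4 (+-cong-⟨mod⟩ p≡ q≡) , ⟨mod⟩-divisor 2∣4 (+-cong-⟨mod⟩ r≡ t≡)

    sums-resp : ∀ {c} → p + q ≡ c ⟨mod + 2 ⟩ × r + t ≡ c ⟨mod + 2 ⟩ →
                p′ + q′ ≡ c ⟨mod + 2 ⟩ × r′ + t′ ≡ c ⟨mod + 2 ⟩
    sums-resp (p+q≡c , r+t≡c) =
      ⟨mod⟩-respˡ (proj₁ sums≡) p+q≡c , ⟨mod⟩-respˡ (proj₂ sums≡) r+t≡c

    2[q+t]≡ : + 2 * (q + t) ≡ + 2 * (q′ + t′) ⟨mod + 4 ⟩
    2[q+t]≡ = *-cong-⟨mod⟩ (⟨mod⟩-refl {+ 2}) (+-cong-⟨mod⟩ q≡ t≡)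

    pq+rt≡ : p * q + r * t ≡ p′ * q′ + r′ * t′ ⟨mod + 4 ⟩
    pq+rt≡ = +-cong-⟨mod⟩ (*-cong-⟨mod⟩ p≡ q≡) (*-cong-⟨mod⟩ r≡ t≡)

    factors-resp : ∀ {c c′ n} → n Signed.∣ + 8 →
      f₀ p′ q′ r′ t′ ≡ c ⟨mod + 4 ⟩ × f₁ p′ q′ r′ t′ ≡ c′ ⟨mod n ⟩ →
      f₀ p q r t ≡ c ⟨mod + 4 ⟩ × f₁ p q r t ≡ c′ ⟨mod n ⟩
    factors-resp n∣8 (f₀≡c , f₁≡c′) =
      ⟨mod⟩-trans (⟨mod⟩-divisor 4∣8 (f-cong-⟨mod⟩ (# 0) (+ 2) p≡ q≡ r≡ t≡)) f₀≡c ,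
      ⟨mod⟩-trans (⟨mod⟩-divisor n∣8 (f-cong-⟨mod⟩ (# 1) (+ 2) p≡ q≡ r≡ t≡)) f₁≡c′

  FactorsWhenSumsEven-resp : FactorsWhenSumsEven p′ q′ r′ t′ → FactorsWhenSumsEven p q r t
  FactorsWhenSumsEven-resp even sums≡0 with even (sums-resp sums≡0)
  ... | 2[q+t]≢0 , 2[q+t]≡0 =
    (λ ¬h → factors-resp 4∣8 (2[q+t]≢0 (¬h ∘ ⟨mod⟩-trans 2[q+t]≡))) ,
    (λ h → factors-resp 4∣8 (2[q+t]≡0 (⟨mod⟩-respˡ 2[q+t]≡ h)))

  FactorsWhenSumsOdd-resp : FactorsWhenSumsOdd p′ q′ r′ t′ → FactorsWhenSumsOdd p q r t
  FactorsWhenSumsOdd-resp odd sums≡1 with odd (sums-resp sums≡1)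
  ... | pq+rt≡2 , pq+rt≡0 =
    (λ h → factors-resp Signed.∣-refl (pq+rt≡2 (⟨mod⟩-respˡ pq+rt≡ h))) ,
    (λ h → factors-resp Signed.∣-refl (pq+rt≡0 (⟨mod⟩-respˡ pq+rt≡ h)))

factorCongruences : ∀ p q r t → FactorCongruences p q r t
factorCongruences p q r t with residue 4 p | residue 4 q | residue 4 r | residue 4 t
... | i , p≡i | j , q≡j | k , r≡k | l , t≡l =
  map (FactorsWhenSumsEven-resp p≡i q≡j r≡k t≡l) (FactorsWhenSumsOdd-resp p≡i q≡j r≡k t≡l)
      (factorCongruences-residues i j k l)

sums≡differences⟨mod2⟩ : ∀ x₀ x₁ x₂ x₃ y₀ y₁ y₂ y₃ →
  ((x₀ + y₀) + (x₂ + y₂)) + ((x₁ + y₁) + (x₃ + y₃))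
    ≡ ((x₀ - y₀) + (x₁ - y₁)) + ((x₂ - y₂) + (x₃ - y₃)) ⟨mod + 2 ⟩
sums≡differences⟨mod2⟩ x₀ x₁ x₂ x₃ y₀ y₁ y₂ y₃ =
  y₀ + y₁ + y₂ + y₃ , solve (x₀ ∷ x₁ ∷ x₂ ∷ x₃ ∷ y₀ ∷ y₁ ∷ y₂ ∷ y₃ ∷ [])

sums≡differences+2⟨mod4⟩ : ∀ u₀ u₁ u₂ u₃ x₀ x₁ x₂ x₃ y₀ y₁ y₂ y₃ →
  (u₀ + (x₀ + y₀)) + (u₁ + (x₁ + y₁)) + (u₂ + (x₂ + y₂)) + (u₃ + (x₃ + y₃))
    ≡ (u₀ - (x₀ + y₀)) + (u₁ - (x₁ + y₁)) + (u₂ - (x₂ + y₂)) + (u₃ - (x₃ + y₃))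
      + + 2 * (((x₀ - y₀) + (x₂ - y₂)) + ((x₁ - y₁) + (x₃ - y₃))) ⟨mod + 4 ⟩
sums≡differences+2⟨mod4⟩ u₀ u₁ u₂ u₃ x₀ x₁ x₂ x₃ y₀ y₁ y₂ y₃ =
  y₀ + y₁ + y₂ + y₃ ,
  solve (u₀ ∷ u₁ ∷ u₂ ∷ u₃ ∷ x₀ ∷ x₁ ∷ x₂ ∷ x₃ ∷ y₀ ∷ y₁ ∷ y₂ ∷ y₃ ∷ [])

module Reduction (a : Fin 16 → ℤ) where

  d : Fin 8 → ℤ
  d = dvec a

  p q r t X : ℤ
  p = d (# 0) + d (# 2)
  q = d (# 4) + d (# 6)
  r = d (# 1) + d (# 3)
  t = d (# 5) + d (# 7)
  X = f₀ (d (# 0) - d (# 2)) (d (# 4) - d (# 6)) (d (# 1) - d (# 3)) (d (# 5) - d (# 7))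

  X≡f₀ : X ≡ f₀ p q r t ⟨mod + 4 ⟩
  X≡f₀ = f-cong-⟨mod⟩ (# 0) (+ 1) (-⟨mod⟩+ (d (# 0)) (d (# 2))) (-⟨mod⟩+ (d (# 4)) (d (# 6)))
                                  (-⟨mod⟩+ (d (# 1)) (d (# 3))) (-⟨mod⟩+ (d (# 5)) (d (# 7)))

  b₀+b₂≡p+q : b0 a + b2 a ≡ p + q ⟨mod + 2 ⟩
  b₀+b₂≡p+q = sums≡differences⟨mod2⟩
    (a (# 0)) (a (# 2)) (a (# 4)) (a (# 6)) (a (# 8)) (a (# 10)) (a (# 12)) (a (# 14))

  b₁+b₃≡r+t : b1 a + b3 a ≡ r + t ⟨mod + 2 ⟩
  b₁+b₃≡r+t = sums≡differences⟨mod2⟩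
    (a (# 1)) (a (# 3)) (a (# 5)) (a (# 7)) (a (# 9)) (a (# 11)) (a (# 13)) (a (# 15))

  Σb≡Σc⇔2[q+t]≡0 : b0 a + b1 a + b2 a + b3 a ≡ c0 a + c1 a + c2 a + c3 a ⟨mod + 4 ⟩
                   ⇔ + 2 * (q + t) ≡ + 0 ⟨mod + 4 ⟩
  Σb≡Σc⇔2[q+t]≡0 = ≡+⇒[≡⇔≡0] (sums≡differences+2⟨mod4⟩
    (a (# 0) + a (# 8)) (a (# 1) + a (# 9)) (a (# 2) + a (# 10)) (a (# 3) + a (# 11))
    (a (# 4)) (a (# 5)) (a (# 6)) (a (# 7)) (a (# 12)) (a (# 13)) (a (# 14)) (a (# 15)))

  p+q,r+t≡ : ∀ {c} → b0 a + b2 a ≡ c [mod + 2 ] × b1 a + b3 a ≡ c [mod + 2 ] →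
             p + q ≡ c ⟨mod + 2 ⟩ × r + t ≡ c ⟨mod + 2 ⟩
  p+q,r+t≡ (b₀+b₂≡c , b₁+b₃≡c) =
    ⟨mod⟩-respˡ b₀+b₂≡p+q ([mod]⇒⟨mod⟩ b₀+b₂≡c) ,
    ⟨mod⟩-respˡ b₁+b₃≡r+t ([mod]⇒⟨mod⟩ b₁+b₃≡c)

lemma4p3 : (a : Fin 16 → ℤ) →
    ((b0 a + b2 a ≡ + 0 [mod + 2 ] × b1 a + b3 a ≡ + 0 [mod + 2 ]) →
      ((¬ (b0 a + b1 a + b2 a + b3 a ≡ c0 a + c1 a + c2 a + c3 a [mod + 4 ]) →
          In2ʲOdd (+ 4) (F (dvec a)))
       × (b0 a + b1 a + b2 a + b3 a ≡ c0 a + c1 a + c2 a + c3 a [mod + 4 ] →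
          In2ʲℤ (+ 16) (F (dvec a)))))
    × ((b0 a + b2 a ≡ + 1 [mod + 2 ] × b1 a + b3 a ≡ + 1 [mod + 2 ]) →
      ((dsc a ≡ + 2 [mod + 4 ] → In2ʲOdd (+ 8) (F (dvec a)))
       × (dsc a ≡ + 0 [mod + 4 ] → In2ʲℤ (+ 16) (F (dvec a)))))
lemma4p3 a =
    (λ sums≡0 → let (2[q+t]≢0 , 2[q+t]≡0) = proj₁ (factorCongruences p q r t) (p+q,r+t≡ sums≡0) in
       (λ Σb≢Σc → let (f₀≡2 , f₁≡2) = 2[q+t]≢0 (Σb≢Σc ∘ ⟨mod⟩⇒[mod] ∘ from) in
          OddMultiple⇒In2ʲOdd (OddMultiple-* (⟨mod⟩-trans X≡f₀ f₀≡2) f₁≡2))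
     , (λ Σb≡Σc → let (f₀≡0 , f₁≡0) = 2[q+t]≡0 (to ([mod]⇒⟨mod⟩ Σb≡Σc)) in
          Signed.∣⇒∣ᵤ (*-pres-∣ (≡0⇒∣ (⟨mod⟩-trans X≡f₀ f₀≡0)) (≡0⇒∣ f₁≡0))))
  , (λ sums≡1 → let (pq+rt≡2 , pq+rt≡0) = proj₂ (factorCongruences p q r t) (p+q,r+t≡ sums≡1) in
       (λ d≡2 → let (f₀≡2 , f₁≡4) = pq+rt≡2 ([mod]⇒⟨mod⟩ d≡2) in
          OddMultiple⇒In2ʲOdd (OddMultiple-* (⟨mod⟩-trans X≡f₀ f₀≡2) f₁≡4))
     , (λ d≡0 → let (f₀≡2 , f₁≡0) = pq+rt≡0 ([mod]⇒⟨mod⟩ d≡0) in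
          Signed.∣⇒∣ᵤ (*-pres-∣ (OddMultiple⇒∣ (⟨mod⟩-trans X≡f₀ f₀≡2)) (≡0⇒∣ f₁≡0))))
  where
  open Reduction a
  open Equivalence Σb≡Σc⇔2[q+t]≡0
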